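{- Let $D$ be a digraph, $\mathcal C\in\mathrm{rs}(D)$ arbitrary, and $F\subseteq A(D^{\mathcal C})$ finite. Then there is a finite $\mathcal C_F\in\mathrm{rs}(D)$ such that $F\subseteq A(D^{\mathcal C_F})$.
   Context: A digraph is an oriented simple graph: no loops, and for distinct $u,v$ at most one of $uv$, $vu$ is an arc. For a directed cycle $C$, $D^{C}$ is the digraph on $V(D)$ with arc set $(A(D)\setminus A(C))\cup\{vu: uv\in A(C)\}$. Reversal sequences $\mathrm{rs}(D)$ and $D^{\mathcal C}$ are defined by transfinite recursion: (1) $\emptyset\in\mathrm{rs}(D)$, $D^\emptyset=D$; (2) if $\mathcal C\in\mathrm{rs}(D)$ and $C^*$ is a directed cycle of $D^{\mathcal C}$ then $\mathcal C^\frown\langle C^*\rangle\in\mathrm{rs}(D)$ and $D^{\mathcal C^\frown\langle C^*\rangle}=(D^{\mathcal C})^{C^*}$; (3) if $\mathcal C_\xi\in\mathrm{rs}(D)$ ($\xi<\zeta$) is an increasing (end-extending) sequence whose union $\mathcal C$ is locally finite (each edge lies in only finitely many cycles of $\mathcal C$), then $\mathcal C\in\mathrm{rs}(D)$ and $uv\in A(D^{\mathcal C})$ iff for some $\nu<\zeta$, $uv\in A(D^{\mathcal C_\xi})$ for all $\nu<\xi<\zeta$. -}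

module Defs where

open import Data.Nat using (ℕ; _≥_)
open import Data.Fin using (Fin)
open import Data.Product using (Σ; ∃; _×_; _,_)
open import Data.Sum using (_⊎_)
open import Data.Empty using (⊥)
open import Data.List using (List; []; _∷_; _++_; [_]; zip; length)
open import Data.List.Membership.Propositional using (_∈_)
open import Data.List.Relation.Unary.Unique.Propositional using (Unique)
open import Relation.Nullary using (¬_)
open import Relation.Binary.PropositionalEquality using (_≡_)
open import Relation.Binary.Structures using (IsStrictTotalOrder)
open import Induction.WellFounded using (WellFounded)
open import Function.Bundles using (_↔_)

record Digraph : Set₁ where
  field
    V     : Set
    Arc   : V → V → Set
    loopless   : ∀ v → ¬ Arc v v
    oriented   : ∀ u v → Arc u v → ¬ Arc v u

ArcRel : Set → Set₁
ArcRel V = V → V → Set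

-- Cycles: a cycle is given by the cyclic list of its (distinct) vertices
-- v₀ v₁ … v_{k-1}; its arcs are v₀v₁, v₁v₂, …, v_{k-1}v₀.

module _ {V : Set} where

  cycPairs : List V → List (V × V)
  cycPairs []       = []
  cycPairs (x ∷ xs) = zip (x ∷ xs) (xs ++ [ x ])

  CArc : List V → V → V → Set
  CArc c u v = (u , v) ∈ cycPairs c

  CEdge : List V → V → V → Set
  CEdge c u v = CArc c u v ⊎ CArc c v u

  IsDirCycle : ArcRel V → List V → Set
  IsDirCycle E c = (length c ≥ 3) × Unique c × (∀ u v → CArc c u v → E u v)

  reverseAlong : ArcRel V → List V → ArcRel V
  reverseAlong E c u v = (E u v × ¬ CArc c u v) ⊎ CArc c v u

-- Transfinite sequences of cycles: indexed by a well-ordered type.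

record Seq (V : Set) : Set₁ where
  field
    I    : Set
    _<_  : I → I → Set
    isSTO : IsStrictTotalOrder _≡_ _<_
    wf   : WellFounded _<_
    cyc  : I → List V

record EndExt {V : Set} (S T : Seq V) : Set where
  module S = Seq S
  module T = Seq T
  field
    emb      : S.I → T.I
    emb-mono : ∀ a b → S._<_ a b → T._<_ (emb a) (emb b)
    emb-refl : ∀ a b → T._<_ (emb a) (emb b) → S._<_ a b
    initial  : ∀ a t → T._<_ t (emb a) → ∃ λ b → emb b ≡ t
    labels   : ∀ a → T.cyc (emb a) ≡ S.cyc a

record OnePointExt {V : Set} (S : Seq V) (c : List V) (T : Seq V) : Set where
  module T = Seq T
  field
    ext     : EndExt S T
    top     : T.I
    top-new : ∀ a → ¬ (EndExt.emb ext a ≡ top)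
    covers  : ∀ t → (∃ λ a → EndExt.emb ext a ≡ t) ⊎ (t ≡ top)
    top-cyc : T.cyc top ≡ c

LocallyFinite : {V : Set} → Seq V → Set
LocallyFinite {V} S = ∀ (u v : V) →
  ∃ λ (l : List I) → ∀ i → CEdge (cyc i) u v → i ∈ l
  where open Seq S

FiniteSeq : {V : Set} → Seq V → Set
FiniteSeq S = ∃ λ (n : ℕ) → Seq.I S ↔ Fin n

-- Reversal sequences: RS D 𝒞 E  means  𝒞 ∈ rs(D) and A(D^𝒞) = E.

data RS (D : Digraph) : Seq (Digraph.V D) → ArcRel (Digraph.V D) → Set₁ where
  rs-empty : (S : Seq (Digraph.V D)) → ¬ Seq.I S →
             RS D S (Digraph.Arc D)
  rs-snoc  : (S : Seq (Digraph.V D)) (E : ArcRel (Digraph.V D)) → RS D S E →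
             (c : List (Digraph.V D)) → IsDirCycle E c →
             (T : Seq (Digraph.V D)) → OnePointExt S c T →
             RS D T (reverseAlong E c)
  -- (3) union of an increasing sequence indexed by a limit ordinal ζ
  rs-limit : (J : Set) (_≺_ : J → J → Set) →
             IsStrictTotalOrder _≡_ _≺_ → WellFounded _≺_ →
             J →                                   -- ζ > 0
             (∀ ξ → ∃ λ η → ξ ≺ η) →
             (Cs : J → Seq (Digraph.V D)) (Es : J → ArcRel (Digraph.V D)) →
             (∀ ξ → RS D (Cs ξ) (Es ξ)) →
             (∀ ξ η → ξ ≺ η → EndExt (Cs ξ) (Cs η)) →
             (C : Seq (Digraph.V D)) →
             (ι : ∀ ξ → EndExt (Cs ξ) C) →
             (∀ i → ∃ λ ξ → ∃ λ a → EndExt.emb (ι ξ) a ≡ i) →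
             LocallyFinite C →
             RS D C (λ u v → ∃ λ ν → ∀ ξ → ν ≺ ξ → Es ξ u v)

-- At a limit stage every arc of F is
-- eventually present, and F is finite, so all of F already lies in some earlier
-- stage. At a successor stage 𝒞 ⌢ ⟨C⟩, the arcs of F not produced by reversing C
-- lie in A(D^𝒞); realise them together with the arcs of C by a finite sequence,
-- along which C is then still a directed cycle, and append C.
module Submission where

open import Defs
open import Data.Product using (Σ; ∃; _×_; _,_; uncurry)
open import Data.List using (List; []; _∷_; _++_)
open import Data.List.Relation.Unary.All as All using (All; []; _∷_)
open import Data.List.Relation.Unary.All.Properties using (++⁺; ++⁻)
open import Data.Nat as ℕ using (ℕ; zero; suc)
open import Data.Nat.Properties using (_≟_; >⇒≢; <-trans)
open import Data.Fin using (Fin; _<_; zero; suc; inject₁; fromℕ; toℕ; lower₁)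
open import Data.Fin.Properties
  using (<-isStrictTotalOrder; toℕ-inject₁; inject₁ℕ<; inject₁-lower₁; fromℕ≢inject₁; toℕ-injective; toℕ-fromℕ)
open import Data.Fin.Induction using (<-wellFounded)
open import Data.Sum using (_⊎_; inj₁; inj₂)
open import Relation.Binary.PropositionalEquality using (_≡_; refl; sym; trans; subst₂)
open import Relation.Binary.Structures using (IsStrictTotalOrder)
open import Relation.Binary.Definitions using (tri<; tri≈; tri>)
open import Relation.Nullary using (yes; no)
open import Function.Construct.Identity using (↔-id)

finSeq : {V : Set} (n : ℕ) → (Fin n → List V) → Seq V
finSeq n cs = record
  { I = Fin n ; _<_ = _<_ ; isSTO = <-isStrictTotalOrder ; wf = <-wellFounded ; cyc = cs }

finSeq-finite : {V : Set} (n : ℕ) (cs : Fin n → List V) → FiniteSeq (finSeq n cs)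
finSeq-finite n cs = n , ↔-id (Fin n)

snoc : {A : Set} {n : ℕ} → (Fin n → A) → A → Fin (suc n) → A
snoc {n = zero}  f x zero    = x
snoc {n = suc n} f x zero    = f zero
snoc {n = suc n} f x (suc i) = snoc (λ j → f (suc j)) x i

snoc-inject₁ : {A : Set} {n : ℕ} (f : Fin n → A) (x : A) (i : Fin n) → snoc f x (inject₁ i) ≡ f i
snoc-inject₁ {n = suc n} f x zero    = refl
snoc-inject₁ {n = suc n} f x (suc i) = snoc-inject₁ (λ j → f (suc j)) x i

snoc-fromℕ : {A : Set} (n : ℕ) (f : Fin n → A) (x : A) → snoc f x (fromℕ n) ≡ x
snoc-fromℕ zero    f x = refl
snoc-fromℕ (suc n) f x = snoc-fromℕ n (λ j → f (suc j)) x

module _ {V : Set} (n : ℕ) (cs : Fin n → List V) (c : List V) where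

  finSeq-snoc-endExt : EndExt (finSeq n cs) (finSeq (suc n) (snoc cs c))
  finSeq-snoc-endExt = record
    { emb      = inject₁
    ; emb-mono = λ a b → subst₂ ℕ._<_ (sym (toℕ-inject₁ a)) (sym (toℕ-inject₁ b))
    ; emb-refl = λ a b → subst₂ ℕ._<_ (toℕ-inject₁ a) (toℕ-inject₁ b)
    ; initial  = λ a t t<a → let n≢t = >⇒≢ (<-trans t<a (inject₁ℕ< a))
                             in lower₁ t n≢t , inject₁-lower₁ t n≢t
    ; labels   = snoc-inject₁ cs c
    }

  finSeq-snoc-onePointExt : OnePointExt (finSeq n cs) c (finSeq (suc n) (snoc cs c))
  finSeq-snoc-onePointExt = record
    { ext     = finSeq-snoc-endExt
    ; top     = fromℕ n
    ; top-new = λ a eq → fromℕ≢inject₁ (sym eq)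
    ; covers  = inject₁-or-fromℕ
    ; top-cyc = snoc-fromℕ n cs c
    }
    where
    inject₁-or-fromℕ : ∀ t → (∃ λ a → inject₁ a ≡ t) ⊎ (t ≡ fromℕ n)
    inject₁-or-fromℕ t with n ≟ toℕ t
    ... | yes n≡t = inj₂ (toℕ-injective (trans (sym n≡t) (sym (toℕ-fromℕ n))))
    ... | no  n≢t = inj₁ (lower₁ t n≢t , inject₁-lower₁ t n≢t)

module _ {V : Set} {E : ArcRel V} {c : List V} where

  cycle-arcs : IsDirCycle E c → All (uncurry E) (cycPairs c)
  cycle-arcs (_ , _ , arcs) = All.tabulate λ {(u , v)} → arcs u v

  IsDirCycle-transfer : {E′ : ArcRel V} → IsDirCycle E c → All (uncurry E′) (cycPairs c) → IsDirCycle E′ c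
  IsDirCycle-transfer (long , unique , _) arcs′ = long , unique , λ u v → All.lookup arcs′

  unreversed : (F : List (V × V)) → All (uncurry (reverseAlong E c)) F → List (V × V)
  unreversed []       []            = []
  unreversed (a ∷ F) (inj₁ _ ∷ ps) = a ∷ unreversed F ps
  unreversed (a ∷ F) (inj₂ _ ∷ ps) = unreversed F ps

  unreversed-arcs : (F : List (V × V)) (ps : All (uncurry (reverseAlong E c)) F) →
                    All (uncurry E) (unreversed F ps)
  unreversed-arcs []      []                  = []
  unreversed-arcs (a ∷ F) (inj₁ (e , _) ∷ ps) = e ∷ unreversed-arcs F ps
  unreversed-arcs (a ∷ F) (inj₂ _ ∷ ps)       = unreversed-arcs F ps

  reverseAlong-from-unreversed : {E′ : ArcRel V} (F : List (V × V)) (ps : All (uncurry (reverseAlong E c)) F) →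
                                 All (uncurry E′) (unreversed F ps) → All (uncurry (reverseAlong E′ c)) F
  reverseAlong-from-unreversed []      []                   []       = []
  reverseAlong-from-unreversed (a ∷ F) (inj₁ (_ , ∉c) ∷ ps) (e ∷ qs) = inj₁ (e , ∉c) ∷ reverseAlong-from-unreversed F ps qs
  reverseAlong-from-unreversed (a ∷ F) (inj₂ rev ∷ ps)      qs       = inj₂ rev ∷ reverseAlong-from-unreversed F ps qs

module _ {J : Set} {_≺_ : J → J → Set} (sto : IsStrictTotalOrder _≡_ _≺_) where
  open IsStrictTotalOrder sto using (compare) renaming (trans to ≺-trans)

  Eventually : (J → Set) → Set
  Eventually P = ∃ λ ν → ∀ ξ → ν ≺ ξ → P ξ

  eventually-all : {A : Set} {P : J → A → Set} → J → (xs : List A) →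
                   All (λ x → Eventually (λ ξ → P ξ x)) xs → Eventually (λ ξ → All (P ξ) xs)
  eventually-all j []       []                 = j , λ _ _ → []
  eventually-all j (x ∷ xs) ((ν₁ , h₁) ∷ evs) with eventually-all j xs evs
  ... | ν₂ , h₂ with compare ν₁ ν₂
  ... | tri< ν₁≺ν₂ _ _ = ν₂ , λ ξ ν₂≺ξ → h₁ ξ (≺-trans ν₁≺ν₂ ν₂≺ξ) ∷ h₂ ξ ν₂≺ξ
  ... | tri≈ _ refl _  = ν₂ , λ ξ ν₂≺ξ → h₁ ξ ν₂≺ξ ∷ h₂ ξ ν₂≺ξ
  ... | tri> _ _ ν₂≺ν₁ = ν₁ , λ ξ ν₁≺ξ → h₁ ξ ν₁≺ξ ∷ h₂ ξ (≺-trans ν₂≺ν₁ ν₁≺ξ)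

finite-rs-realising : (D : Digraph) (C : Seq (Digraph.V D)) (E : ArcRel (Digraph.V D)) → RS D C E →
  (F : List (Digraph.V D × Digraph.V D)) → All (uncurry E) F →
  ∃ λ n → ∃ λ (cs : Fin n → List (Digraph.V D)) → ∃ λ EF →
    RS D (finSeq n cs) EF × All (uncurry EF) F
finite-rs-realising D C E (rs-empty S _) F ps =
  0 , (λ ()) , Digraph.Arc D , rs-empty (finSeq 0 (λ ())) (λ ()) , ps
finite-rs-realising D C E (rs-snoc S E₀ r c cycle _ _) F ps
  with finite-rs-realising D S E₀ r (cycPairs c ++ unreversed F ps)
      (++⁺ (cycle-arcs {c = c} cycle) (unreversed-arcs {E = E₀} {c} F ps))
... | n , cs , EF , rsF , qs with ++⁻ (cycPairs c) qs
... | cycle-arcsF , unreversed-arcsF =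
  suc n , snoc cs c , reverseAlong EF c ,
  rs-snoc (finSeq n cs) EF rsF c (IsDirCycle-transfer {c = c} cycle cycle-arcsF) _ (finSeq-snoc-onePointExt n cs c) ,
  reverseAlong-from-unreversed {E = E₀} {c} F ps unreversed-arcsF
finite-rs-realising D C E (rs-limit J _≺_ sto _ j no-last Cs Es rss _ _ _ _ _) F ps
  with eventually-all sto j F ps
... | ν , h with no-last ν
... | ξ , ν≺ξ = finite-rs-realising D (Cs ξ) (Es ξ) (rss ξ) F (h ξ ν≺ξ)

corollary8p5 : (D : Digraph) (C : Seq (Digraph.V D)) (E : ArcRel (Digraph.V D)) →
    RS D C E →
    (F : List (Digraph.V D × Digraph.V D)) →
    All (λ { (u , v) → E u v }) F →
    Σ (Seq (Digraph.V D)) λ CF → Σ (ArcRel (Digraph.V D)) λ EF →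
      RS D CF EF × FiniteSeq CF × All (λ { (u , v) → EF u v }) F
corollary8p5 D C E r F ps with finite-rs-realising D C E r F ps
... | n , cs , EF , rsF , qs = finSeq n cs , EF , rsF , finSeq-finite n cs , qs
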